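{- Let $p$ be an odd prime, $G=\mathrm{Sym}(\mathbb{F}_p)=S_p$ and $H=\mathrm{AGL}(1,p)\leq G$ (the group of permutations $v\mapsto av+b$ of $\mathbb{F}_p$ with $a\in\mathbb{F}_p^\times$, $b\in\mathbb{F}_p$). Then $H$ is a perfect code of $G$.
   Context: Graphs are finite, undirected and simple; a subset $C$ of the vertex set $V$ of a graph is a perfect code if every vertex in $V\setminus C$ is adjacent to exactly one vertex of $C$. For a group $G$ and an inverse-closed $S\subseteq G\setminus\{e\}$, the Cayley graph $\mathrm{Cay}(G,S)$ has vertex set $G$ and edges $\{g,sg\}$ ($s\in S$, $g\in G$); a subset of $G$ is a perfect code of $G$ if it is a perfect code in some Cayley graph of $G$. -}

module Defs where

open import Data.Nat using (ℕ; NonZero; _+_; _*_)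
open import Data.Nat.DivMod using (_%_)
open import Data.Fin using (Fin; toℕ)
open import Data.Vec using (Vec; lookup; tabulate)
open import Data.Product using (Σ; ∃; _×_)
open import Relation.Binary.PropositionalEquality using (_≡_; _≢_)
open import Relation.Nullary using (¬_)

-- A permutation of the n-element set Fin n is encoded by its table of
-- images (a vector of length n), required to be injective (hence bijective).
Table : ℕ → Set
Table n = Vec (Fin n) n

IsPerm : ∀ {n} → Table n → Set
IsPerm σ = ∀ i j → lookup σ i ≡ lookup σ j → i ≡ j

_·_ : ∀ {n} → Table n → Table n → Table n
σ · τ = tabulate (λ i → lookup σ (lookup τ i))

ι : ∀ {n} → Table n
ι = tabulate (λ i → i)

Subset : ℕ → Set₁
Subset n = Table n → Set

IsConnectionSet : ∀ {n} → Subset n → Set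
IsConnectionSet {n} S =
  (∀ s → S s → IsPerm s × s ≢ ι) ×
  (∀ s t → S s → t · s ≡ ι → S t)

Adj : ∀ {n} → Subset n → Table n → Table n → Set
Adj S g h = ∃ λ s → S s × h ≡ s · g

IsPerfectCodeIn : ∀ {n} → Subset n → Subset n → Set
IsPerfectCodeIn S C =
  (∀ c → C c → IsPerm c) ×
  (∀ v → IsPerm v → ¬ C v →
     ∃ λ c → (C c × Adj S c v) ×
             (∀ c′ → C c′ → Adj S c′ v → c′ ≡ c))

IsPerfectCodeOfSym : ∀ {n} → Subset n → Set₁
IsPerfectCodeOfSym {n} C = ∃ λ (S : Subset n) → IsConnectionSet S × IsPerfectCodeIn S C

-- AGL(1,p) inside Sym(F_p), with F_p identified with Fin p (residues mod p):
-- the permutations v ↦ a v + b with a ≠ 0.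
AGL1 : (p : ℕ) → .{{NonZero p}} → Subset p
AGL1 p σ = ∃ λ (a : Fin p) → ∃ λ (b : Fin p) →
  (toℕ a ≢ 0) × (∀ v → toℕ (lookup σ v) ≡ (toℕ a * toℕ v + toℕ b) % p)

{-# OPTIONS --safe #-}
-- Let K be the pointwise stabiliser of two points 0, 1 in Sym(p) and S = K ∖ {e}.
-- Then c is adjacent to v in Cay(Sym(p), S) iff c ≠ v and Kc = Kv, so every right
-- transversal of K is a perfect code. Since Kc = Kv iff c⁻¹ and v⁻¹ agree on 0 and 1,
-- a set of permutations is such a transversal as soon as, for all distinct x₀, x₁,
-- exactly one of its members maps x₀ ↦ 0 and x₁ ↦ 1. AGL(1,p) has this property
-- because it is sharply 2-transitive: x ↦ (x − x₀)/(x₁ − x₀) is the unique affine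
-- map doing so, as x₁ − x₀ is invertible modulo the prime p.
module Submission where

open import Defs
open import Data.Nat using (ℕ; NonZero)
open import Data.Nat.Divisibility using (_∣_)
open import Data.Nat.Primality using (Prime)
open import Relation.Nullary using (¬_)

open import Data.Nat as ℕ using (suc; _<_)
import Data.Nat.Properties as ℕ
open import Data.Nat.Divisibility using (∣1⇒≡1; n∣m⇒m%n≡0)
open import Data.Nat.DivMod using (_%_; m<n⇒m%n≡m)
open import Data.Nat.Primality using (euclidsLemma; prime⇒nonTrivial)
open import Data.Integer using (ℤ; +_; -_; _+_; _-_; _*_; 0ℤ; 1ℤ; ∣_∣)
import Data.Integer.Properties as ℤ
open import Data.Integer.DivMod using (_%ℕ_; _/ℕ_; n%ℕd<d; a≡a%ℕn+[a/ℕn]*n)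
open import Data.Integer.Divisibility.Signed as ℤ∣ using (divides) renaming (_∣_ to _∣ℤ_)
open import Data.Integer.Tactic.RingSolver using (solve; solve-∀)
open import Data.Fin using (Fin; toℕ; fromℕ<; punchOut)
open import Data.Fin.Properties
  using (toℕ-injective; toℕ-fromℕ<; toℕ<n; any?; _≟_; injective⇒≤; punchOut-injective)
open import Data.Vec using (lookup; tabulate)
open import Data.Vec.Properties using (lookup∘tabulate; tabulate∘lookup; tabulate-cong)
open import Data.List using (_∷_; [])
open import Data.Product using (∃; ∃₂; _×_; _,_; proj₁; proj₂)
import Data.Sum as Sum
open import Data.Sum using (_⊎_; inj₁; inj₂)
open import Function using (_∘_)
open import Function.Definitions using (Injective)
open import Relation.Nullary using (yes; no; contradiction)
open import Relation.Binary.Bundles using (Setoid)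
open import Relation.Binary.PropositionalEquality
import Relation.Binary.Reasoning.Setoid as SetoidReasoning

injective⇒surjective : ∀ {n} {f : Fin n → Fin n} → Injective _≡_ _≡_ f → ∀ y → ∃ λ x → f x ≡ y
injective⇒surjective {suc n} {f} f-injective y with any? (λ x → f x ≟ y)
... | yes hit  = hit
... | no  miss = contradiction (injective⇒≤ punchOut-y-injective) (ℕ.1+n≰n {n})
  where
  y≢f : ∀ x → y ≢ f x
  y≢f x y≡fx = miss (x , sym y≡fx)

  punchOut-y : Fin (suc n) → Fin n
  punchOut-y x = punchOut (y≢f x)

  punchOut-y-injective : Injective _≡_ _≡_ punchOut-y
  punchOut-y-injective eq = f-injective (punchOut-injective (y≢f _) (y≢f _) eq)

module _ {n : ℕ} where

  lookup-· : ∀ (σ τ : Table n) i → lookup (σ · τ) i ≡ lookup σ (lookup τ i)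
  lookup-· σ τ = lookup∘tabulate _

  lookup-ι : ∀ i → lookup (ι {n}) i ≡ i
  lookup-ι = lookup∘tabulate _

  table-ext : ∀ {σ τ : Table n} → (∀ i → lookup σ i ≡ lookup τ i) → σ ≡ τ
  table-ext {σ} {τ} σ≗τ = begin
    σ                   ≡⟨ tabulate∘lookup σ ⟨
    tabulate (lookup σ) ≡⟨ tabulate-cong σ≗τ ⟩
    tabulate (lookup τ) ≡⟨ tabulate∘lookup τ ⟩
    τ                   ∎
    where open ≡-Reasoning

  ·-identityˡ : ∀ σ → ι · σ ≡ σ
  ·-identityˡ σ = table-ext λ i → trans (lookup-· ι σ i) (lookup-ι (lookup σ i))

  ·-isPerm : ∀ σ τ → IsPerm σ → IsPerm τ → IsPerm (σ · τ)
  ·-isPerm σ τ σ-perm τ-perm i j eq =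
    τ-perm i j (σ-perm _ _ (trans (sym (lookup-· σ τ i)) (trans eq (lookup-· σ τ j))))

  leftInverse-lookup : ∀ s t → t · s ≡ ι → ∀ i → lookup t (lookup s i) ≡ i
  leftInverse-lookup s t t·s≡ι i = begin
    lookup t (lookup s i) ≡⟨ lookup-· t s i ⟨
    lookup (t · s) i      ≡⟨ cong (λ σ → lookup σ i) t·s≡ι ⟩
    lookup ι i            ≡⟨ lookup-ι i ⟩
    i                     ∎
    where open ≡-Reasoning

  module _ (σ : Table n) (σ-perm : IsPerm σ) where

    isPerm⇒surjective : ∀ y → ∃ λ x → lookup σ x ≡ y
    isPerm⇒surjective = injective⇒surjective (σ-perm _ _)

    preimage : Fin n → Fin n
    preimage y = proj₁ (isPerm⇒surjective y)

    lookup-preimage : ∀ y → lookup σ (preimage y) ≡ y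
    lookup-preimage y = proj₂ (isPerm⇒surjective y)

    preimage-lookup : ∀ x → preimage (lookup σ x) ≡ x
    preimage-lookup x = σ-perm _ _ (lookup-preimage (lookup σ x))

    inverse : Table n
    inverse = tabulate preimage

    lookup-inverse : ∀ y → lookup inverse y ≡ preimage y
    lookup-inverse = lookup∘tabulate preimage

    preimage-injective : ∀ {y y′} → preimage y ≡ preimage y′ → y ≡ y′
    preimage-injective {y} {y′} eq = begin
      y                      ≡⟨ lookup-preimage y ⟨
      lookup σ (preimage y)  ≡⟨ cong (lookup σ) eq ⟩
      lookup σ (preimage y′) ≡⟨ lookup-preimage y′ ⟩
      y′                     ∎
      where open ≡-Reasoning

    inverse-isPerm : IsPerm inverse
    inverse-isPerm y y′ eq =
      preimage-injective (trans (sym (lookup-inverse y)) (trans eq (lookup-inverse y′)))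

  leftInverse-isPerm : ∀ s t → IsPerm s → t · s ≡ ι → IsPerm t
  leftInverse-isPerm s t s-perm t·s≡ι j j′ tj≡tj′
    with x , refl ← isPerm⇒surjective s s-perm j
       | x′ , refl ← isPerm⇒surjective s s-perm j′
    = cong (lookup s) (begin
        x                      ≡⟨ t∘s≗id x ⟨
        lookup t (lookup s x)  ≡⟨ tj≡tj′ ⟩
        lookup t (lookup s x′) ≡⟨ t∘s≗id x′ ⟩
        x′                     ∎)
    where
    open ≡-Reasoning
    t∘s≗id : ∀ i → lookup t (lookup s i) ≡ i
    t∘s≗id = leftInverse-lookup s t t·s≡ι

  divideʳ : ∀ v c → IsPerm v → IsPerm c → ∃ λ s → IsPerm s × s · c ≡ v
  divideʳ v c v-perm c-perm =
    v · c⁻¹ , ·-isPerm v c⁻¹ v-perm (inverse-isPerm c c-perm) , table-ext λ i → begin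
      lookup ((v · c⁻¹) · c) i                  ≡⟨ lookup-· (v · c⁻¹) c i ⟩
      lookup (v · c⁻¹) (lookup c i)             ≡⟨ lookup-· v c⁻¹ (lookup c i) ⟩
      lookup v (lookup c⁻¹ (lookup c i))        ≡⟨ cong (lookup v) (lookup-inverse c c-perm _) ⟩
      lookup v (preimage c c-perm (lookup c i)) ≡⟨ cong (lookup v) (preimage-lookup c c-perm i) ⟩
      lookup v i                                ∎
    where
    open ≡-Reasoning

    c⁻¹ : Table n
    c⁻¹ = inverse c c-perm

record IsRightTransversal {n} (K C : Subset n) : Set where
  field
    meets     : ∀ v → IsPerm v → ∃₂ λ s c → K s × C c × v ≡ s · c
    meetsOnce : ∀ s s′ c c′ → K s → K s′ → C c → C c′ → s · c ≡ s′ · c′ → c ≡ c′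

rightTransversal⇒perfectCode : ∀ {n} {K C : Subset n} →
  (∀ s → K s → IsPerm s) → (∀ s t → K s → t · s ≡ ι → K t) →
  (∀ c → C c → IsPerm c) → IsRightTransversal K C → IsPerfectCodeOfSym C
rightTransversal⇒perfectCode {K = K} {C} K-perm K-inverse C-perm transversal =
  S , (S-nontrivial , S-inverse) , C-perm , cover
  where
  open IsRightTransversal transversal

  S : Subset _
  S s = K s × s ≢ ι

  S-nontrivial : ∀ s → S s → IsPerm s × s ≢ ι
  S-nontrivial s (Ks , s≢ι) = K-perm s Ks , s≢ι

  S-inverse : ∀ s t → S s → t · s ≡ ι → S t
  S-inverse s t (Ks , s≢ι) t·s≡ι = K-inverse s t Ks t·s≡ι , t≢ι
    where
    t≢ι : t ≢ ι
    t≢ι refl = s≢ι (trans (sym (·-identityˡ s)) t·s≡ι)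

  cover : ∀ v → IsPerm v → ¬ C v →
          ∃ λ c → (C c × Adj S c v) × (∀ c′ → C c′ → Adj S c′ v → c′ ≡ c)
  cover v v-perm v∉C with s , c , Ks , Cc , v≡s·c ← meets v v-perm =
    c , (Cc , s , (Ks , s≢ι) , v≡s·c) , unique
    where
    s≢ι : s ≢ ι
    s≢ι refl = v∉C (subst C (sym (trans v≡s·c (·-identityˡ c))) Cc)

    unique : ∀ c′ → C c′ → Adj S c′ v → c′ ≡ c
    unique c′ Cc′ (s′ , (Ks′ , _) , v≡s′·c′) =
      sym (meetsOnce s s′ c c′ Ks Ks′ Cc Cc′ (trans (sym v≡s·c) v≡s′·c′))

Stabiliser : ∀ {n} → Fin n → Fin n → Subset n
Stabiliser o l s = IsPerm s × lookup s o ≡ o × lookup s l ≡ l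

stabiliser-inverse : ∀ {n} {o l : Fin n} s t → Stabiliser o l s → t · s ≡ ι → Stabiliser o l t
stabiliser-inverse s t (s-perm , so≡o , sl≡l) t·s≡ι =
  leftInverse-isPerm s t s-perm t·s≡ι , fixed so≡o , fixed sl≡l
  where
  fixed : ∀ {x} → lookup s x ≡ x → lookup t x ≡ x
  fixed {x} sx≡x = trans (cong (lookup t) (sym sx≡x)) (leftInverse-lookup s t t·s≡ι x)

stabiliser-rightTransversal : ∀ {n} {o l : Fin n} {C : Subset n} → o ≢ l →
  (∀ c → C c → IsPerm c) →
  (∀ {x₀ x₁} → x₀ ≢ x₁ → ∃ λ c → C c × lookup c x₀ ≡ o × lookup c x₁ ≡ l) →
  (∀ {c c′ x₀ x₁} → C c → C c′ → x₀ ≢ x₁ →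
     lookup c x₀ ≡ lookup c′ x₀ → lookup c x₁ ≡ lookup c′ x₁ → c ≡ c′) →
  IsRightTransversal (Stabiliser o l) C
stabiliser-rightTransversal {n} {o} {l} {C} o≢l C-perm C-reaches C-determined =
  record { meets = meets ; meetsOnce = meetsOnce }
  where
  open ≡-Reasoning

  fixes : ∀ s c {v x y} → s · c ≡ v → lookup c x ≡ y → lookup v x ≡ y → lookup s y ≡ y
  fixes s c {v} {x} {y} s·c≡v cx≡y vx≡y = begin
    lookup s y            ≡⟨ cong (lookup s) cx≡y ⟨
    lookup s (lookup c x) ≡⟨ lookup-· s c x ⟨
    lookup (s · c) x      ≡⟨ cong (λ σ → lookup σ x) s·c≡v ⟩
    lookup v x            ≡⟨ vx≡y ⟩
    y                     ∎

  meets : ∀ v → IsPerm v → ∃₂ λ s c → Stabiliser o l s × C c × v ≡ s · c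
  meets v v-perm
    with c , Cc , cx₀≡o , cx₁≡l ← C-reaches (o≢l ∘ preimage-injective v v-perm)
    with s , s-perm , s·c≡v ← divideʳ v c v-perm (C-perm c Cc)
    = s , c , (s-perm , fixes s c s·c≡v cx₀≡o (lookup-preimage v v-perm o)
                      , fixes s c s·c≡v cx₁≡l (lookup-preimage v v-perm l)) , Cc , sym s·c≡v

  meetsOnce : ∀ s s′ c c′ → Stabiliser o l s → Stabiliser o l s′ → C c → C c′ →
              s · c ≡ s′ · c′ → c ≡ c′
  meetsOnce s s′ c c′ (_ , so≡o , sl≡l) (s′-perm , s′o≡o , s′l≡l) Cc Cc′ s·c≡s′·c′ =
    C-determined {c} {c′} Cc Cc′ (o≢l ∘ preimage-injective c c-perm)
      (agree (lookup-preimage c c-perm o) so≡o s′o≡o)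
      (agree (lookup-preimage c c-perm l) sl≡l s′l≡l)
    where
    c-perm : IsPerm c
    c-perm = C-perm c Cc

    agree : ∀ {x y} → lookup c x ≡ y → lookup s y ≡ y → lookup s′ y ≡ y → lookup c x ≡ lookup c′ x
    agree {x} {y} cx≡y sy≡y s′y≡y = trans cx≡y (sym (s′-perm _ _ (begin
      lookup s′ (lookup c′ x) ≡⟨ lookup-· s′ c′ x ⟨
      lookup (s′ · c′) x      ≡⟨ cong (λ σ → lookup σ x) s·c≡s′·c′ ⟨
      lookup (s · c) x        ≡⟨ lookup-· s c x ⟩
      lookup s (lookup c x)   ≡⟨ cong (lookup s) cx≡y ⟩
      lookup s y              ≡⟨ sy≡y ⟩
      y                       ≡⟨ s′y≡y ⟨
      lookup s′ y             ∎)))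

module Residues (p : ℕ) .{{_ : NonZero p}} where

  -- A record rather than a synonym for divisibility, so that x and y can be inferred.
  infix 4 _≋_
  record _≋_ (x y : ℤ) : Set where
    constructor mk≋
    field p∣x-y : + p ∣ℤ x - y

  private
    neg-[x-y] : ∀ x y → - (x - y) ≡ y - x
    neg-[x-y] = solve-∀

    [x+u]-[y+v] : ∀ x u y v → (x + u) - (y + v) ≡ (x - y) + (u - v)
    [x+u]-[y+v] = solve-∀

    [x-u]-[y-v] : ∀ x u y v → (x - u) - (y - v) ≡ (x - y) - (u - v)
    [x-u]-[y-v] = solve-∀

    xu-yv : ∀ x u y v → x * u - y * v ≡ (x - y) * u + y * (u - v)
    xu-yv = solve-∀

    ax-ay : ∀ a x y → a * x - a * y ≡ a * (x - y)
    ax-ay = solve-∀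

  ≋-reflexive : ∀ {x y} → x ≡ y → x ≋ y
  ≋-reflexive {x} refl = mk≋ (divides 0ℤ (ℤ.+-inverseʳ x))

  ≋-refl : ∀ {x} → x ≋ x
  ≋-refl = ≋-reflexive refl

  ≋-sym : ∀ {x y} → x ≋ y → y ≋ x
  ≋-sym {x} {y} (mk≋ x≋y) = mk≋ (subst (+ p ∣ℤ_) (neg-[x-y] x y) (ℤ∣.∣m⇒∣-m x≋y))

  ≋-trans : ∀ {x y z} → x ≋ y → y ≋ z → x ≋ z
  ≋-trans {x} {y} {z} (mk≋ x≋y) (mk≋ y≋z) =
    mk≋ (subst (+ p ∣ℤ_) (ℤ.+-minus-telescope x y z) (ℤ∣.∣m∣n⇒∣m+n x≋y y≋z))

  ≋-setoid : Setoid _ _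
  ≋-setoid = record
    { Carrier       = ℤ
    ; _≈_           = _≋_
    ; isEquivalence = record { refl = ≋-refl ; sym = ≋-sym ; trans = ≋-trans }
    }

  module ≋-Reasoning = SetoidReasoning ≋-setoid

  +-cong : ∀ {x y u v} → x ≋ y → u ≋ v → x + u ≋ y + v
  +-cong {x} {y} {u} {v} (mk≋ x≋y) (mk≋ u≋v) =
    mk≋ (subst (+ p ∣ℤ_) (sym ([x+u]-[y+v] x u y v)) (ℤ∣.∣m∣n⇒∣m+n x≋y u≋v))

  minus-cong : ∀ {x y u v} → x ≋ y → u ≋ v → x - u ≋ y - v
  minus-cong {x} {y} {u} {v} (mk≋ x≋y) (mk≋ u≋v) =
    mk≋ (subst (+ p ∣ℤ_) (sym ([x-u]-[y-v] x u y v)) (ℤ∣.∣m∣n⇒∣m-n x≋y u≋v))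

  *-cong : ∀ {x y u v} → x ≋ y → u ≋ v → x * u ≋ y * v
  *-cong {x} {y} {u} {v} (mk≋ x≋y) (mk≋ u≋v) =
    mk≋ (subst (+ p ∣ℤ_) (sym (xu-yv x u y v)) (ℤ∣.∣m∣n⇒∣m+n (ℤ∣.∣m⇒∣m*n u x≋y) (ℤ∣.∣n⇒∣m*n y u≋v)))

  ∣⇒≋0 : ∀ {x} → + p ∣ℤ x → x ≋ 0ℤ
  ∣⇒≋0 {x} p∣x = mk≋ (subst (+ p ∣ℤ_) (sym (ℤ.+-identityʳ x)) p∣x)

  ≋0⇒∣ : ∀ {x} → x ≋ 0ℤ → + p ∣ℤ x
  ≋0⇒∣ {x} (mk≋ x≋0) = subst (+ p ∣ℤ_) (ℤ.+-identityʳ x) x≋0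

  +-cancelʳ-≋ : ∀ {x y z} → x + z ≋ y + z → x ≋ y
  +-cancelʳ-≋ {x} {y} {z} x+z≋y+z = begin
    x           ≡⟨ solve (x ∷ z ∷ []) ⟩
    (x + z) - z ≈⟨ minus-cong x+z≋y+z ≋-refl ⟩
    (y + z) - z ≡⟨ solve (y ∷ z ∷ []) ⟩
    y           ∎
    where open ≋-Reasoning

  ∣∧<⇒≡0 : ∀ {n} → p ∣ n → n < p → n ≡ 0
  ∣∧<⇒≡0 p∣n n<p = trans (sym (m<n⇒m%n≡m n<p)) (n∣m⇒m%n≡0 _ p p∣n)

  ≋-<⇒≡ : ∀ {m n} → m < p → n < p → + m ≋ + n → m ≡ n
  ≋-<⇒≡ {m} {n} m<p n<p (mk≋ m≋n) = ℤ.+-injective (ℤ.i-j≡0⇒i≡j (+ m) (+ n) (ℤ.∣i∣≡0⇒i≡0 ∣m-n∣≡0))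
    where
    ∣m-n∣<p : ∣ + m - + n ∣ < p
    ∣m-n∣<p = subst (_< p) (cong ∣_∣ (sym (ℤ.m-n≡m⊖n m n)))
                (ℕ.≤-<-trans (ℤ.∣m⊝n∣≤m⊔n m n) (ℕ.⊔-pres-<m m<p n<p))

    ∣m-n∣≡0 : ∣ + m - + n ∣ ≡ 0
    ∣m-n∣≡0 = ∣∧<⇒≡0 (ℤ∣.∣⇒∣ᵤ m≋n) ∣m-n∣<p

  toℤ : Fin p → ℤ
  toℤ x = + toℕ x

  toℤ-injective : ∀ {x y} → toℤ x ≋ toℤ y → x ≡ y
  toℤ-injective x≋y = toℕ-injective (≋-<⇒≡ (toℕ<n _) (toℕ<n _) x≋y)

  reduce : ℤ → Fin p
  reduce x = fromℕ< (n%ℕd<d x p)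

  toℕ-reduce : ∀ n → toℕ (reduce (+ n)) ≡ n % p
  toℕ-reduce n = toℕ-fromℕ< _

  toℤ-reduce : ∀ x → toℤ (reduce x) ≋ x
  toℤ-reduce x = ≋-sym (begin
    x                            ≡⟨ a≡a%ℕn+[a/ℕn]*n x p ⟩
    + (x %ℕ p) + (x /ℕ p) * + p  ≈⟨ +-cong (≋-refl {+ (x %ℕ p)}) (∣⇒≋0 (divides (x /ℕ p) refl)) ⟩
    + (x %ℕ p) + 0ℤ              ≡⟨ ℤ.+-identityʳ _ ⟩
    + (x %ℕ p)                   ≡⟨ cong +_ (toℕ-fromℕ< _) ⟨
    toℤ (reduce x)               ∎)
    where open ≋-Reasoning

  reduce-toℤ : ∀ x → reduce (toℤ x) ≡ x
  reduce-toℤ x = toℕ-injective (trans (toℕ-reduce (toℕ x)) (m<n⇒m%n≡m (toℕ<n x)))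

  reduce-cong : ∀ {x y} → x ≋ y → reduce x ≡ reduce y
  reduce-cong {x} {y} x≋y = toℤ-injective (begin
    toℤ (reduce x) ≈⟨ toℤ-reduce x ⟩
    x              ≈⟨ x≋y ⟩
    y              ≈⟨ toℤ-reduce y ⟨
    toℤ (reduce y) ∎)
    where open ≋-Reasoning

  reduce-injective : ∀ {x y} → reduce x ≡ reduce y → x ≋ y
  reduce-injective {x} {y} eq = begin
    x              ≈⟨ toℤ-reduce x ⟨
    toℤ (reduce x) ≡⟨ cong toℤ eq ⟩
    toℤ (reduce y) ≈⟨ toℤ-reduce y ⟩
    y              ∎
    where open ≋-Reasoning

  -- Integer coefficients, so that differences such as x₁ − x₀ are not truncated as in ℕ.
  affine : ℤ → ℤ → Fin p → Fin p
  affine α β x = reduce (α * toℤ x + β)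

  affine-cong : ∀ {α β α′ β′} → α ≋ α′ → β ≋ β′ → ∀ x → affine α β x ≡ affine α′ β′ x
  affine-cong α≋α′ β≋β′ x = reduce-cong (+-cong (*-cong α≋α′ ≋-refl) β≋β′)

  pos-affine : ∀ a x b → + (a ℕ.* x ℕ.+ b) ≡ + a * + x + + b
  pos-affine a x b = trans (ℤ.pos-+ (a ℕ.* x) b) (cong (_+ + b) (ℤ.pos-* a x))

  AGL1⇒affine : ∀ {σ} → AGL1 p σ → ∃₂ λ α β → ¬ (+ p ∣ℤ α) × (∀ x → lookup σ x ≡ affine α β x)
  AGL1⇒affine {σ} (a , b , a≢0 , σ-values) = toℤ a , toℤ b , p∤a , σ≗affine
    where
    p∤a : ¬ (+ p ∣ℤ toℤ a)
    p∤a p∣a = a≢0 (∣∧<⇒≡0 (ℤ∣.∣⇒∣ᵤ p∣a) (toℕ<n a))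

    σ≗affine : ∀ x → lookup σ x ≡ affine (toℤ a) (toℤ b) x
    σ≗affine x = toℕ-injective (begin
      toℕ (lookup σ x)                             ≡⟨ σ-values x ⟩
      (toℕ a ℕ.* toℕ x ℕ.+ toℕ b) % p              ≡⟨ toℕ-reduce _ ⟨
      toℕ (reduce (+ (toℕ a ℕ.* toℕ x ℕ.+ toℕ b))) ≡⟨ cong (toℕ ∘ reduce) (pos-affine (toℕ a) (toℕ x) (toℕ b)) ⟩
      toℕ (affine (toℤ a) (toℤ b) x)               ∎)
      where open ≡-Reasoning

  affine⇒AGL1 : ∀ {α} β → ¬ (+ p ∣ℤ α) → AGL1 p (tabulate (affine α β))
  affine⇒AGL1 {α} β p∤α = a , b , a≢0 , values
    where
    a b : Fin p
    a = reduce α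
    b = reduce β

    a≢0 : toℕ a ≢ 0
    a≢0 a≡0 = p∤α (≋0⇒∣ (begin
      α     ≈⟨ toℤ-reduce α ⟨
      toℤ a ≡⟨ cong +_ a≡0 ⟩
      0ℤ    ∎))
      where open ≋-Reasoning

    values : ∀ x → toℕ (lookup (tabulate (affine α β)) x) ≡ (toℕ a ℕ.* toℕ x ℕ.+ toℕ b) % p
    values x = begin
      toℕ (lookup (tabulate (affine α β)) x)       ≡⟨ cong toℕ (lookup∘tabulate (affine α β) x) ⟩
      toℕ (affine α β x)                           ≡⟨ cong toℕ (affine-cong (≋-sym (toℤ-reduce α)) (≋-sym (toℤ-reduce β)) x) ⟩
      toℕ (affine (toℤ a) (toℤ b) x)               ≡⟨ cong (toℕ ∘ reduce) (pos-affine (toℕ a) (toℕ x) (toℕ b)) ⟨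
      toℕ (reduce (+ (toℕ a ℕ.* toℕ x ℕ.+ toℕ b))) ≡⟨ toℕ-reduce _ ⟩
      (toℕ a ℕ.* toℕ x ℕ.+ toℕ b) % p              ∎
      where open ≡-Reasoning

  module _ (p-prime : Prime p) where

    1≉0 : ¬ (1ℤ ≋ 0ℤ)
    1≉0 (mk≋ p∣1) =
      ℕ.<-irrefl (sym (∣1⇒≡1 (ℤ∣.∣⇒∣ᵤ p∣1))) (ℕ.nonTrivial⇒n>1 p {{prime⇒nonTrivial p-prime}})

    reduce-0≢1 : reduce 0ℤ ≢ reduce 1ℤ
    reduce-0≢1 eq = 1≉0 (≋-sym (reduce-injective eq))

    euclid : ∀ x y → + p ∣ℤ x * y → + p ∣ℤ x ⊎ + p ∣ℤ y
    euclid x y p∣xy = Sum.map ℤ∣.∣ᵤ⇒∣ ℤ∣.∣ᵤ⇒∣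
      (euclidsLemma ∣ x ∣ ∣ y ∣ p-prime (subst (p ∣_) (ℤ.abs-* x y) (ℤ∣.∣⇒∣ᵤ p∣xy)))

    *-cancelˡ-≋ : ∀ {a x y} → ¬ (+ p ∣ℤ a) → a * x ≋ a * y → x ≋ y
    *-cancelˡ-≋ {a} {x} {y} p∤a (mk≋ p∣ax-ay) with euclid a (x - y) (subst (+ p ∣ℤ_) (ax-ay a x y) p∣ax-ay)
    ... | inj₁ p∣a   = contradiction p∣a p∤a
    ... | inj₂ p∣x-y = mk≋ p∣x-y

    affine-injective : ∀ {α} β → ¬ (+ p ∣ℤ α) → Injective _≡_ _≡_ (affine α β)
    affine-injective {α} β p∤α {x} {y} eq =
      toℤ-injective (*-cancelˡ-≋ p∤α (+-cancelʳ-≋ (reduce-injective {α * toℤ x + β} {α * toℤ y + β} eq)))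

    affine-surjective : ∀ {α} β → ¬ (+ p ∣ℤ α) → ∀ y → ∃ λ x → affine α β x ≡ y
    affine-surjective {α} β p∤α = injective⇒surjective {f = affine α β} (affine-injective β p∤α)

    ≋-invertible : ∀ {d} → ¬ (+ p ∣ℤ d) → ∃ λ u → u * d ≋ 1ℤ
    ≋-invertible {d} p∤d = toℤ y , (begin
      toℤ y * d       ≡⟨ trans (ℤ.*-comm (toℤ y) d) (sym (ℤ.+-identityʳ _)) ⟩
      d * toℤ y + 0ℤ  ≈⟨ reduce-injective {d * toℤ y + 0ℤ} {1ℤ} dy≡1 ⟩
      1ℤ              ∎)
      where
      open ≋-Reasoning

      y : Fin p
      y = proj₁ (affine-surjective 0ℤ p∤d (reduce 1ℤ))

      dy≡1 : affine d 0ℤ y ≡ reduce 1ℤ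
      dy≡1 = proj₂ (affine-surjective 0ℤ p∤d (reduce 1ℤ))

    affine-≋-determined : ∀ {α β α′ β′ x₀ x₁} → ¬ (x₁ ≋ x₀) →
      α * x₀ + β ≋ α′ * x₀ + β′ → α * x₁ + β ≋ α′ * x₁ + β′ → α ≋ α′ × β ≋ β′
    affine-≋-determined {α} {β} {α′} {β′} {x₀} {x₁} x₁≉x₀ e₀ e₁ = α≋α′ , β≋β′
      where
      open ≋-Reasoning

      α≋α′ : α ≋ α′
      α≋α′ = *-cancelˡ-≋ (x₁≉x₀ ∘ mk≋) (begin
        (x₁ - x₀) * α                   ≡⟨ solve (α ∷ β ∷ x₀ ∷ x₁ ∷ []) ⟩
        (α * x₁ + β) - (α * x₀ + β)     ≈⟨ minus-cong e₁ e₀ ⟩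
        (α′ * x₁ + β′) - (α′ * x₀ + β′) ≡⟨ solve (α′ ∷ β′ ∷ x₀ ∷ x₁ ∷ []) ⟩
        (x₁ - x₀) * α′                  ∎)

      β≋β′ : β ≋ β′
      β≋β′ = begin
        β                        ≡⟨ solve (α ∷ β ∷ x₀ ∷ []) ⟩
        (α * x₀ + β) - α * x₀    ≈⟨ minus-cong e₀ (*-cong α≋α′ ≋-refl) ⟩
        (α′ * x₀ + β′) - α′ * x₀ ≡⟨ solve (α′ ∷ β′ ∷ x₀ ∷ []) ⟩
        β′                       ∎

    affine-≋-through : ∀ {x₀ x₁ y₀ y₁ u} → u * (x₁ - x₀) ≋ 1ℤ → ¬ (y₁ ≋ y₀) →
      ∃₂ λ α β → ¬ (+ p ∣ℤ α) × α * x₀ + β ≋ y₀ × α * x₁ + β ≋ y₁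
    affine-≋-through {x₀} {x₁} {y₀} {y₁} {u} u[x₁-x₀]≋1 y₁≉y₀ =
      (y₁ - y₀) * u , y₀ - (y₁ - y₀) * u * x₀ , p∤α , ≋-reflexive (solve (u ∷ x₀ ∷ y₀ ∷ y₁ ∷ [])) , at-x₁
      where
      open ≋-Reasoning

      p∤α : ¬ (+ p ∣ℤ (y₁ - y₀) * u)
      p∤α p∣α with euclid (y₁ - y₀) u p∣α
      ... | inj₁ p∣y₁-y₀ = y₁≉y₀ (mk≋ p∣y₁-y₀)
      ... | inj₂ p∣u     = 1≉0 (begin
        1ℤ            ≈⟨ u[x₁-x₀]≋1 ⟨
        u * (x₁ - x₀) ≈⟨ ∣⇒≋0 (ℤ∣.∣m⇒∣m*n (x₁ - x₀) p∣u) ⟩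
        0ℤ            ∎)

      at-x₁ : (y₁ - y₀) * u * x₁ + (y₀ - (y₁ - y₀) * u * x₀) ≋ y₁
      at-x₁ = begin
        (y₁ - y₀) * u * x₁ + (y₀ - (y₁ - y₀) * u * x₀) ≡⟨ solve (u ∷ x₀ ∷ x₁ ∷ y₀ ∷ y₁ ∷ []) ⟩
        (y₁ - y₀) * (u * (x₁ - x₀)) + y₀               ≈⟨ +-cong (*-cong (≋-refl {y₁ - y₀}) u[x₁-x₀]≋1) (≋-refl {y₀}) ⟩
        (y₁ - y₀) * 1ℤ + y₀                            ≡⟨ solve (y₀ ∷ y₁ ∷ []) ⟩
        y₁                                             ∎

    AGL1-isPerm : ∀ σ → AGL1 p σ → IsPerm σ
    AGL1-isPerm σ σ∈AGL1 i j σi≡σj =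
      let α , β , p∤α , σ≗affine = AGL1⇒affine {σ} σ∈AGL1
      in  affine-injective β p∤α (trans (sym (σ≗affine i)) (trans σi≡σj (σ≗affine j)))

    AGL1-2-transitive : ∀ {x₀ x₁ y₀ y₁} → x₀ ≢ x₁ → y₀ ≢ y₁ →
      ∃ λ σ → AGL1 p σ × lookup σ x₀ ≡ y₀ × lookup σ x₁ ≡ y₁
    AGL1-2-transitive {x₀} {x₁} {y₀} {y₁} x₀≢x₁ y₀≢y₁ =
      let u , u[x₁-x₀]≋1 = ≋-invertible (x₀≢x₁ ∘ sym ∘ toℤ-injective ∘ mk≋)
          α , β , p∤α , at-x₀ , at-x₁ = affine-≋-through {toℤ x₀} {toℤ x₁} {toℤ y₀} {toℤ y₁} {u}
                                          u[x₁-x₀]≋1 (y₀≢y₁ ∘ sym ∘ toℤ-injective)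
          sends : ∀ {x y} → α * toℤ x + β ≋ toℤ y → lookup (tabulate (affine α β)) x ≡ y
          sends {x} {y} e = trans (lookup∘tabulate (affine α β) x) (trans (reduce-cong e) (reduce-toℤ y))
      in  tabulate (affine α β) , affine⇒AGL1 β p∤α , sends at-x₀ , sends at-x₁

    AGL1-determined : ∀ {σ τ x₀ x₁} → AGL1 p σ → AGL1 p τ → x₀ ≢ x₁ →
      lookup σ x₀ ≡ lookup τ x₀ → lookup σ x₁ ≡ lookup τ x₁ → σ ≡ τ
    AGL1-determined {σ} {τ} {x₀} {x₁} σ∈AGL1 τ∈AGL1 x₀≢x₁ e₀ e₁ =
      let α  , β  , _ , σ≗affine = AGL1⇒affine {σ} σ∈AGL1
          α′ , β′ , _ , τ≗affine = AGL1⇒affine {τ} τ∈AGL1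
          agree : ∀ {x} → lookup σ x ≡ lookup τ x → α * toℤ x + β ≋ α′ * toℤ x + β′
          agree {x} e = reduce-injective {α * toℤ x + β} {α′ * toℤ x + β′}
                          (trans (sym (σ≗affine x)) (trans e (τ≗affine x)))
          α≋α′ , β≋β′ = affine-≋-determined {α} {β} {α′} {β′}
                          (x₀≢x₁ ∘ sym ∘ toℤ-injective) (agree e₀) (agree e₁)
      in  table-ext λ x → begin
            lookup σ x     ≡⟨ σ≗affine x ⟩
            affine α β x   ≡⟨ affine-cong α≋α′ β≋β′ x ⟩
            affine α′ β′ x ≡⟨ τ≗affine x ⟨
            lookup τ x     ∎
      where open ≡-Reasoning

proposition4p3 : (p : ℕ) .{{_ : NonZero p}} → Prime p → ¬ (2 ∣ p) → IsPerfectCodeOfSym (AGL1 p)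
proposition4p3 p p-prime _ =
  rightTransversal⇒perfectCode (λ _ → proj₁) stabiliser-inverse (AGL1-isPerm p-prime)
    (stabiliser-rightTransversal (reduce-0≢1 p-prime) (AGL1-isPerm p-prime)
       (λ x₀≢x₁ → AGL1-2-transitive p-prime x₀≢x₁ (reduce-0≢1 p-prime)) (AGL1-determined p-prime))
  where open Residues p
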